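{- Let $m,n$ be positive integers. The vertices of $P(m,n)$ are exactly the $m\times n$ sign matrices.
   Context: A sign matrix is a matrix with entries in $\{ -1,0,1\}$ all of whose column partial sums from the top $\sum_{i'=1}^{i}M_{i'j}$ lie in $\{0,1\}$ and all of whose row partial sums from the left $\sum_{j'=1}^{j}M_{ij'}$ are nonnegative. $P(m,n)$ is the convex hull in $\mathbb{R}^{mn}$ of all $m\times n$ sign matrices.
   Formalization: P(m,n) is taken in ℚ^(mn) instead of $\mathbb{R}^{mn}$, with rational convex-combination coefficients, and extremality is tested only against points with rational coordinates and rational weights. -}

module Defs where

open import Data.Nat using (ℕ; zero; suc)
open import Data.Fin using (Fin; zero; suc; toℕ)
open import Data.Rational using (ℚ; 0ℚ; 1ℚ; -_; _+_; _*_; _-_; _≤_; _<_)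
open import Data.Product using (Σ; _×_; ∃)
open import Data.Sum using (_⊎_)
open import Relation.Binary.PropositionalEquality using (_≡_)

-- real-valued (here: rational-valued) m × n matrices, i.e. points of ℚ^{mn}
Matrix : ℕ → ℕ → Set
Matrix m n = Fin m → Fin n → ℚ

-- sum of the first k entries of a finite sequence (all entries if k ≥ length)
sumUpTo : ∀ {m} → (Fin m → ℚ) → ℕ → ℚ
sumUpTo {zero}  f k       = 0ℚ
sumUpTo {suc m} f zero    = 0ℚ
sumUpTo {suc m} f (suc k) = f zero + sumUpTo (λ i → f (suc i)) k

sumFin : ∀ {m} → (Fin m → ℚ) → ℚ
sumFin {zero}  f = 0ℚ
sumFin {suc m} f = f zero + sumFin (λ i → f (suc i))

IsSignMatrix : ∀ {m n} → Matrix m n → Set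
IsSignMatrix {m} {n} M =
  (∀ i j → (M i j ≡ - 1ℚ) ⊎ (M i j ≡ 0ℚ) ⊎ (M i j ≡ 1ℚ))
  × (∀ (i : Fin m) (j : Fin n) →
       let s = sumUpTo (λ i' → M i' j) (suc (toℕ i)) in (s ≡ 0ℚ) ⊎ (s ≡ 1ℚ))
  × (∀ (i : Fin m) (j : Fin n) → 0ℚ ≤ sumUpTo (λ j' → M i j') (suc (toℕ j)))

InP : ∀ m n → Matrix m n → Set
InP m n x =
  Σ ℕ λ k → Σ (Fin k → ℚ) λ c → Σ (Fin k → Matrix m n) λ S →
    (∀ t → IsSignMatrix (S t))
    × (∀ t → 0ℚ ≤ c t)
    × (sumFin c ≡ 1ℚ)
    × (∀ i j → x i j ≡ sumFin (λ t → c t * S t i j))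

IsVertex : ∀ m n → Matrix m n → Set
IsVertex m n x =
  InP m n x
  × (∀ (y z : Matrix m n) (t : ℚ) → InP m n y → InP m n z →
       0ℚ < t → t < 1ℚ →
       (∀ i j → x i j ≡ t * y i j + (1ℚ - t) * z i j) →
       (∀ i j → y i j ≡ x i j) × (∀ i j → z i j ≡ x i j))

module Submission where

-- Sign matrices → vertices.  The j-th column partial sums of a point of
-- P(m,n) are convex combinations of column partial sums of sign matrices,
-- hence lie in [0,1] (colSum-unit).  For a sign matrix X they lie in {0,1},
-- and 0 and 1 are extreme points of [0,1] (unit-extreme).  So if
-- X = t·Y + (1-t)·Z with Y, Z ∈ P(m,n) and 0 < t < 1, then Y and Z have the
-- same column partial sums as X, and partial sums determine the entries.
--
-- Vertices → sign matrices.  This is the general fact that an extreme point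
-- of the convex hull of a set Q lies in Q (extreme⇒generator), proved by
-- induction on the length of a convex combination: a first weight 0 is
-- dropped, a first weight 1 makes x the first generator, and a first weight
-- c ∈ (0,1) writes x = c·S₀ + (1-c)·z with z the renormalised tail, so
-- extremality forces x = S₀.

open import Defs
open import Data.Nat using (ℕ; _≤_)
open import Function.Bundles using (_⇔_)

open import Data.Nat using (zero; suc)
open import Data.Fin using (Fin; zero; suc; toℕ)
open import Data.Rational
  using (ℚ; 0ℚ; 1ℚ; -_; _+_; _*_; _-_; 1/_; positive; nonNegative)
  renaming (_≤_ to _≤ℚ_; _<_ to _<ℚ_)
open import Data.Rational.Properties
open import Data.Rational.Solver using (module +-*-Solver)
open +-*-Solver using (solve; _:=_; _:+_; _:-_; _:*_; con)
open import Algebra.Properties.Group +-0-group using (∙-cancelˡ; x∙y⁻¹≈ε⇒x≈y)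
open import Data.Product using (Σ; _×_; _,_; proj₁; proj₂)
open import Data.Sum using (_⊎_; inj₁; inj₂)
open import Data.Empty using (⊥-elim)
open import Relation.Binary.PropositionalEquality
open import Relation.Binary.Definitions using (Tri; tri<; tri≈; tri>)
open import Function.Bundles using (mk⇔)
open ≡-Reasoning

*-nonNeg : ∀ {a b} → 0ℚ ≤ℚ a → 0ℚ ≤ℚ b → 0ℚ ≤ℚ a * b
*-nonNeg {a} {b} a≥0 b≥0 =
  nonNegative⁻¹ _ {{nonNeg*nonNeg⇒nonNeg a {{nonNegative a≥0}} b {{nonNegative b≥0}}}}

≤⇒0≤- : ∀ {a b} → a ≤ℚ b → 0ℚ ≤ℚ b - a
≤⇒0≤- {a} {b} a≤b = subst (_≤ℚ b - a) (+-inverseʳ a) (+-monoˡ-≤ (- a) a≤b)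

<⇒0<- : ∀ {a b} → a <ℚ b → 0ℚ <ℚ b - a
<⇒0<- {a} {b} a<b = subst (_<ℚ b - a) (+-inverseʳ a) (+-monoˡ-< (- a) a<b)

≤-of-sum : ∀ {a b s} → 0ℚ ≤ℚ b → a + b ≡ s → a ≤ℚ s
≤-of-sum {a} b≥0 a+b≡s = subst₂ _≤ℚ_ (+-identityʳ a) a+b≡s (+-monoʳ-≤ a b≥0)

nonNeg-sum-zeroˡ : ∀ {a b} → 0ℚ ≤ℚ a → 0ℚ ≤ℚ b → a + b ≡ 0ℚ → a ≡ 0ℚ
nonNeg-sum-zeroˡ a≥0 b≥0 a+b≡0 = ≤-antisym (≤-of-sum b≥0 a+b≡0) a≥0

pos-*-zero : ∀ {t b} → 0ℚ <ℚ t → t * b ≡ 0ℚ → b ≡ 0ℚ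
pos-*-zero {t} {b} t>0 tb≡0 = begin
  b                ≡⟨ *-identityˡ b ⟨
  1ℚ * b           ≡⟨ cong (_* b) (*-inverseˡ t) ⟨
  (1/ t * t) * b   ≡⟨ *-assoc (1/ t) t b ⟩
  1/ t * (t * b)   ≡⟨ cong (1/ t *_) tb≡0 ⟩
  1/ t * 0ℚ        ≡⟨ *-zeroʳ (1/ t) ⟩
  0ℚ               ∎
  where instance _ = pos⇒nonZero t {{positive t>0}}

zero-extreme : ∀ {t b c} → 0ℚ <ℚ t → t <ℚ 1ℚ → 0ℚ ≤ℚ b → 0ℚ ≤ℚ c →
               t * b + (1ℚ - t) * c ≡ 0ℚ → (b ≡ 0ℚ) × (c ≡ 0ℚ)
zero-extreme {t} {b} {c} t>0 t<1 b≥0 c≥0 e =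
  pos-*-zero t>0 (nonNeg-sum-zeroˡ tb≥0 sc≥0 e) ,
  pos-*-zero s>0 (nonNeg-sum-zeroˡ sc≥0 tb≥0 (trans (+-comm ((1ℚ - t) * c) (t * b)) e))
  where
  s>0 = <⇒0<- t<1
  tb≥0 = *-nonNeg (<⇒≤ t>0) b≥0
  sc≥0 = *-nonNeg (<⇒≤ s>0) c≥0

-- Dually 1 is an extreme point of (-∞,1]: apply zero-extreme to 1-b, 1-c.
one-extreme : ∀ {t b c} → 0ℚ <ℚ t → t <ℚ 1ℚ → b ≤ℚ 1ℚ → c ≤ℚ 1ℚ →
              t * b + (1ℚ - t) * c ≡ 1ℚ → (b ≡ 1ℚ) × (c ≡ 1ℚ)
one-extreme {t} {b} {c} t>0 t<1 b≤1 c≤1 e =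
  sym (x∙y⁻¹≈ε⇒x≈y 1ℚ b (proj₁ gaps)) , sym (x∙y⁻¹≈ε⇒x≈y 1ℚ c (proj₂ gaps))
  where
  complement : t * (1ℚ - b) + (1ℚ - t) * (1ℚ - c) ≡ 0ℚ
  complement = begin
    t * (1ℚ - b) + (1ℚ - t) * (1ℚ - c) ≡⟨ solve 3 (λ t b c →
        t :* (con 1ℚ :- b) :+ (con 1ℚ :- t) :* (con 1ℚ :- c)
        := con 1ℚ :- (t :* b :+ (con 1ℚ :- t) :* c)) refl t b c ⟩
    1ℚ - (t * b + (1ℚ - t) * c)        ≡⟨ cong (λ v → 1ℚ - v) e ⟩
    1ℚ - 1ℚ                            ≡⟨ +-inverseʳ 1ℚ ⟩
    0ℚ                                 ∎
  gaps = zero-extreme t>0 t<1 (≤⇒0≤- b≤1) (≤⇒0≤- c≤1) complement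

unit-extreme : ∀ {a t b c} → 0ℚ <ℚ t → t <ℚ 1ℚ →
               0ℚ ≤ℚ b → b ≤ℚ 1ℚ → 0ℚ ≤ℚ c → c ≤ℚ 1ℚ →
               (a ≡ 0ℚ) ⊎ (a ≡ 1ℚ) → a ≡ t * b + (1ℚ - t) * c →
               (b ≡ a) × (c ≡ a)
unit-extreme t>0 t<1 b≥0 _ c≥0 _ (inj₁ refl) e =
  zero-extreme t>0 t<1 b≥0 c≥0 (sym e)
unit-extreme t>0 t<1 _ b≤1 _ c≤1 (inj₂ refl) e =
  one-extreme t>0 t<1 b≤1 c≤1 (sym e)

sumFin-cong : ∀ {k} {f g : Fin k → ℚ} → (∀ t → f t ≡ g t) → sumFin f ≡ sumFin g
sumFin-cong {zero}  f≗g = refl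
sumFin-cong {suc k} f≗g = cong₂ _+_ (f≗g zero) (sumFin-cong (λ t → f≗g (suc t)))

+-interchange : ∀ a b c d → (a + b) + (c + d) ≡ (a + c) + (b + d)
+-interchange = solve 4 (λ a b c d → (a :+ b) :+ (c :+ d) := (a :+ c) :+ (b :+ d)) refl

sumFin-scale : ∀ {k} a (f : Fin k → ℚ) → sumFin (λ t → a * f t) ≡ a * sumFin f
sumFin-scale {zero}  a f = sym (*-zeroʳ a)
sumFin-scale {suc k} a f =
  trans (cong (a * f zero +_) (sumFin-scale a (λ t → f (suc t))))
        (sym (*-distribˡ-+ a _ _))

sumFin-zero : ∀ {k} (f : Fin k → ℚ) → (∀ t → f t ≡ 0ℚ) → sumFin f ≡ 0ℚ
sumFin-zero {zero}  f f≡0 = refl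
sumFin-zero {suc k} f f≡0 =
  trans (cong₂ _+_ (f≡0 zero) (sumFin-zero (λ t → f (suc t)) (λ t → f≡0 (suc t))))
        (+-identityʳ 0ℚ)

sumFin-mono : ∀ {k} (f g : Fin k → ℚ) → (∀ t → f t ≤ℚ g t) → sumFin f ≤ℚ sumFin g
sumFin-mono {zero}  f g f≤g = ≤-refl
sumFin-mono {suc k} f g f≤g =
  +-mono-≤ (f≤g zero) (sumFin-mono (λ t → f (suc t)) (λ t → g (suc t)) (λ t → f≤g (suc t)))

sumFin-nonNeg : ∀ {k} (f : Fin k → ℚ) → (∀ t → 0ℚ ≤ℚ f t) → 0ℚ ≤ℚ sumFin f
sumFin-nonNeg {k} f f≥0 = subst (_≤ℚ sumFin f) (sumFin-zero {k} (λ _ → 0ℚ) (λ _ → refl))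
                                (sumFin-mono (λ _ → 0ℚ) f f≥0)

nonNeg-sumFin-zero : ∀ {k} (f : Fin k → ℚ) → (∀ t → 0ℚ ≤ℚ f t) →
                     sumFin f ≡ 0ℚ → ∀ t → f t ≡ 0ℚ
nonNeg-sumFin-zero {suc k} f f≥0 Σ≡0 zero =
  nonNeg-sum-zeroˡ (f≥0 zero) (sumFin-nonNeg _ (λ t → f≥0 (suc t))) Σ≡0
nonNeg-sumFin-zero {suc k} f f≥0 Σ≡0 (suc t) =
  nonNeg-sumFin-zero (λ t → f (suc t)) (λ t → f≥0 (suc t)) tail≡0 t
  where
  tail≡0 : sumFin (λ t → f (suc t)) ≡ 0ℚ
  tail≡0 = nonNeg-sum-zeroˡ (sumFin-nonNeg _ (λ t → f≥0 (suc t))) (f≥0 zero)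
                            (trans (+-comm _ (f zero)) Σ≡0)

combination-unit : ∀ {k} (c v : Fin k → ℚ) → (∀ t → 0ℚ ≤ℚ c t) → sumFin c ≡ 1ℚ →
  (∀ t → (0ℚ ≤ℚ v t) × (v t ≤ℚ 1ℚ)) →
  (0ℚ ≤ℚ sumFin (λ t → c t * v t)) × (sumFin (λ t → c t * v t) ≤ℚ 1ℚ)
combination-unit c v c≥0 Σc≡1 v∈[0,1] =
  sumFin-nonNeg _ (λ t → *-nonNeg (c≥0 t) (proj₁ (v∈[0,1] t))) ,
  subst (sumFin (λ t → c t * v t) ≤ℚ_) Σc≡1 (sumFin-mono _ c λ t →
    subst (c t * v t ≤ℚ_) (*-identityʳ (c t)) (*-monoˡ-≤-nonNeg (c t) {{nonNegative (c≥0 t)}} (proj₂ (v∈[0,1] t))))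

sumUpTo-cong : ∀ {m} {f g : Fin m → ℚ} → (∀ i → f i ≡ g i) →
               ∀ K → sumUpTo f K ≡ sumUpTo g K
sumUpTo-cong {zero}  f≗g K       = refl
sumUpTo-cong {suc m} f≗g zero    = refl
sumUpTo-cong {suc m} f≗g (suc K) = cong₂ _+_ (f≗g zero) (sumUpTo-cong (λ i → f≗g (suc i)) K)

sumUpTo-+ : ∀ {m} (f g : Fin m → ℚ) K →
            sumUpTo (λ i → f i + g i) K ≡ sumUpTo f K + sumUpTo g K
sumUpTo-+ {zero}  f g K       = sym (+-identityʳ 0ℚ)
sumUpTo-+ {suc m} f g zero    = sym (+-identityʳ 0ℚ)
sumUpTo-+ {suc m} f g (suc K) =
  trans (cong (f zero + g zero +_) (sumUpTo-+ (λ i → f (suc i)) (λ i → g (suc i)) K))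
        (+-interchange (f zero) (g zero) _ _)

sumUpTo-scale : ∀ {m} a (f : Fin m → ℚ) K → sumUpTo (λ i → a * f i) K ≡ a * sumUpTo f K
sumUpTo-scale {zero}  a f K       = sym (*-zeroʳ a)
sumUpTo-scale {suc m} a f zero    = sym (*-zeroʳ a)
sumUpTo-scale {suc m} a f (suc K) =
  trans (cong (a * f zero +_) (sumUpTo-scale a (λ i → f (suc i)) K))
        (sym (*-distribˡ-+ a _ _))

sumUpTo-zero : ∀ {m} K → sumUpTo {m} (λ _ → 0ℚ) K ≡ 0ℚ
sumUpTo-zero {zero}  K       = refl
sumUpTo-zero {suc m} zero    = refl
sumUpTo-zero {suc m} (suc K) = trans (+-identityˡ _) (sumUpTo-zero {m} K)

sumUpTo-empty : ∀ {m} (f : Fin m → ℚ) → sumUpTo f 0 ≡ 0ℚ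
sumUpTo-empty {zero}  f = refl
sumUpTo-empty {suc m} f = refl

sumUpTo-combination : ∀ {m k} (c : Fin k → ℚ) (g : Fin k → Fin m → ℚ) K →
  sumUpTo (λ i → sumFin (λ t → c t * g t i)) K ≡ sumFin (λ t → c t * sumUpTo (g t) K)
sumUpTo-combination {m} {zero}  c g K = sumUpTo-zero {m} K
sumUpTo-combination {m} {suc k} c g K = begin
  sumUpTo (λ i → c zero * g zero i + sumFin (λ t → c (suc t) * g (suc t) i)) K
    ≡⟨ sumUpTo-+ (λ i → c zero * g zero i)
                 (λ i → sumFin (λ t → c (suc t) * g (suc t) i)) K ⟩
  sumUpTo (λ i → c zero * g zero i) K
    + sumUpTo (λ i → sumFin (λ t → c (suc t) * g (suc t) i)) K
    ≡⟨ cong₂ _+_ (sumUpTo-scale (c zero) (g zero) K)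
                 (sumUpTo-combination (λ t → c (suc t)) (λ t → g (suc t)) K) ⟩
  c zero * sumUpTo (g zero) K + sumFin (λ t → c (suc t) * sumUpTo (g (suc t)) K)
    ∎

partialSums-injective : ∀ {m} (f g : Fin m → ℚ) →
  (∀ (i : Fin m) → sumUpTo f (suc (toℕ i)) ≡ sumUpTo g (suc (toℕ i))) →
  ∀ i → f i ≡ g i
partialSums-injective {suc m} f g same zero = begin
  f zero                                 ≡⟨ +-identityʳ (f zero) ⟨
  f zero + 0ℚ                            ≡⟨ cong (f zero +_) (sumUpTo-empty (λ i → f (suc i))) ⟨
  f zero + sumUpTo (λ i → f (suc i)) 0   ≡⟨ same zero ⟩
  g zero + sumUpTo (λ i → g (suc i)) 0   ≡⟨ cong (g zero +_) (sumUpTo-empty (λ i → g (suc i))) ⟩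
  g zero + 0ℚ                            ≡⟨ +-identityʳ (g zero) ⟩
  g zero                                 ∎
partialSums-injective {suc m} f g same (suc i) =
  partialSums-injective (λ i → f (suc i)) (λ i → g (suc i)) same-tail i
  where
  same-head = partialSums-injective f g same zero
  same-tail : ∀ (i : Fin m) → sumUpTo (λ i → f (suc i)) (suc (toℕ i))
                            ≡ sumUpTo (λ i → g (suc i)) (suc (toℕ i))
  same-tail i = ∙-cancelˡ (f zero) _ _
    (trans (same (suc i)) (cong (_+ sumUpTo (λ i → g (suc i)) (suc (toℕ i))) (sym same-head)))

_≗ₘ_ : ∀ {m n} → Matrix m n → Matrix m n → Set
A ≗ₘ B = ∀ i j → A i j ≡ B i j

IsConvexCombination : ∀ {m n k} → (Fin k → ℚ) → (Fin k → Matrix m n) → Matrix m n → Set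
IsConvexCombination c S x =
  (∀ t → 0ℚ ≤ℚ c t) × (sumFin c ≡ 1ℚ) × (x ≗ₘ λ i j → sumFin (λ t → c t * S t i j))

-- The convex hull of Q.  InP m n is, by definition, InHull IsSignMatrix.
InHull : ∀ {m n} → (Matrix m n → Set) → Matrix m n → Set
InHull {m} {n} Q x = Σ ℕ λ k → Σ (Fin k → ℚ) λ c → Σ (Fin k → Matrix m n) λ S →
  (∀ t → Q (S t)) × IsConvexCombination c S x

IsExtreme : ∀ {m n} → (Matrix m n → Set) → Matrix m n → Set
IsExtreme C x = ∀ y z t → C y → C z → 0ℚ <ℚ t → t <ℚ 1ℚ →
  (x ≗ₘ λ i j → t * y i j + (1ℚ - t) * z i j) → (y ≗ₘ x) × (z ≗ₘ x)

generator-in-hull : ∀ {m n} {Q : Matrix m n → Set} {X} → Q X → InHull Q X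
generator-in-hull {X = X} QX =
  1 , (λ _ → 1ℚ) , (λ _ → X) , (λ _ → QX) , (λ _ → <⇒≤ (positive⁻¹ 1ℚ)) , +-identityʳ 1ℚ ,
  λ i j → sym (trans (+-identityʳ _) (*-identityˡ _))

module FirstTerm {m n k} {c : Fin (suc k) → ℚ} {S : Fin (suc k) → Matrix m n} {x : Matrix m n}
                 (comb : IsConvexCombination c S x) where
  private
    c≥0 = proj₁ comb
    tail-weight = sumFin (λ t → c (suc t))
    tail-value : Matrix m n
    tail-value i j = sumFin (λ t → c (suc t) * S (suc t) i j)

    tail-weight≥0 : 0ℚ ≤ℚ tail-weight
    tail-weight≥0 = sumFin-nonNeg _ (λ t → c≥0 (suc t))

    tail-weight≡ : tail-weight ≡ 1ℚ - c zero
    tail-weight≡ = begin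
      tail-weight                      ≡⟨ solve 2 (λ a r → r := (a :+ r) :- a) refl (c zero) tail-weight ⟩
      (c zero + tail-weight) - c zero  ≡⟨ cong (λ v → v - c zero) (proj₁ (proj₂ comb)) ⟩
      1ℚ - c zero                      ∎

  head-weight≤1 : c zero ≤ℚ 1ℚ
  head-weight≤1 = ≤-of-sum tail-weight≥0 (proj₁ (proj₂ comb))

  drop-zero-head : c zero ≡ 0ℚ →
    IsConvexCombination (λ t → c (suc t)) (λ t → S (suc t)) x
  drop-zero-head c₀≡0 =
    (λ t → c≥0 (suc t)) , trans tail-weight≡ (cong (λ v → 1ℚ - v) c₀≡0) , λ i j → begin
      x i j                                  ≡⟨ proj₂ (proj₂ comb) i j ⟩
      c zero * S zero i j + tail-value i j   ≡⟨ cong (λ v → v * S zero i j + tail-value i j) c₀≡0 ⟩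
      0ℚ * S zero i j + tail-value i j       ≡⟨ cong (_+ tail-value i j) (*-zeroˡ (S zero i j)) ⟩
      0ℚ + tail-value i j                    ≡⟨ +-identityˡ (tail-value i j) ⟩
      tail-value i j                         ∎

  -- A first weight 1 forces all other weights to vanish, so x = S zero.
  unit-head : c zero ≡ 1ℚ → x ≗ₘ S zero
  unit-head c₀≡1 i j = begin
    x i j                                  ≡⟨ proj₂ (proj₂ comb) i j ⟩
    c zero * S zero i j + tail-value i j   ≡⟨ cong₂ _+_ (cong (_* S zero i j) c₀≡1) tail-vanishes ⟩
    1ℚ * S zero i j + 0ℚ                   ≡⟨ +-identityʳ _ ⟩
    1ℚ * S zero i j                        ≡⟨ *-identityˡ _ ⟩
    S zero i j                             ∎
    where
    tail-weights≡0 = nonNeg-sumFin-zero _ (λ t → c≥0 (suc t))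
      (trans tail-weight≡ (trans (cong (λ v → 1ℚ - v) c₀≡1) (+-inverseʳ 1ℚ)))
    tail-vanishes : tail-value i j ≡ 0ℚ
    tail-vanishes = sumFin-zero _ λ t →
      trans (cong (_* S (suc t) i j) (tail-weights≡0 t)) (*-zeroˡ (S (suc t) i j))

  -- A first weight c₀ ∈ (0,1) writes x = c₀ · S zero + (1 - c₀) · z with z
  -- a convex combination of the remaining points (the tail renormalised by
  -- 1/(1 - c₀)).
  split-head : 0ℚ <ℚ c zero → c zero <ℚ 1ℚ →
    Σ (Matrix m n) λ z →
      (Σ (Fin k → ℚ) λ w → IsConvexCombination w (λ t → S (suc t)) z)
      × (x ≗ₘ λ i j → c zero * S zero i j + (1ℚ - c zero) * z i j)
  split-head c₀>0 c₀<1 = z , (w , w≥0 , w-sum , λ i j → refl) , x-split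
    where
    d = 1ℚ - c zero
    d>0 = <⇒0<- c₀<1
    instance _ = pos⇒nonZero d {{positive d>0}}
    w : Fin k → ℚ
    w t = c (suc t) * 1/ d
    z : Matrix m n
    z i j = sumFin (λ t → w t * S (suc t) i j)
    w≥0 : ∀ t → 0ℚ ≤ℚ w t
    w≥0 t = *-nonNeg (c≥0 (suc t)) (<⇒≤ (positive⁻¹ _ {{1/pos⇒pos d {{positive d>0}}}}))
    w-sum : sumFin w ≡ 1ℚ
    w-sum = begin
      sumFin w                 ≡⟨ sumFin-cong (λ t → *-comm (c (suc t)) (1/ d)) ⟩
      sumFin (λ t → 1/ d * c (suc t)) ≡⟨ sumFin-scale (1/ d) (λ t → c (suc t)) ⟩
      1/ d * tail-weight       ≡⟨ cong (1/ d *_) tail-weight≡ ⟩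
      1/ d * d                 ≡⟨ *-inverseˡ d ⟩
      1ℚ                       ∎
    rescale : ∀ i j → d * z i j ≡ tail-value i j
    rescale i j = begin
      d * z i j                                   ≡⟨ sumFin-scale d (λ t → w t * S (suc t) i j) ⟨
      sumFin (λ t → d * (w t * S (suc t) i j))    ≡⟨ sumFin-cong {k} (λ t →
        solve 4 (λ d a e s → d :* ((a :* e) :* s) := (d :* e) :* (a :* s))
                refl d (c (suc t)) (1/ d) (S (suc t) i j)) ⟩
      sumFin (λ t → (d * 1/ d) * (c (suc t) * S (suc t) i j))
        ≡⟨ sumFin-cong {k} (λ t →
             trans (cong (_* (c (suc t) * S (suc t) i j)) (*-inverseʳ d)) (*-identityˡ _)) ⟩
      tail-value i j                              ∎
    x-split : x ≗ₘ λ i j → c zero * S zero i j + d * z i j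
    x-split i j = trans (proj₂ (proj₂ comb) i j) (cong (c zero * S zero i j +_) (sym (rescale i j)))

module _ {m n} {Q : Matrix m n → Set} (Q-resp : ∀ {A B} → A ≗ₘ B → Q A → Q B)
         {x : Matrix m n} (x-extreme : IsExtreme (InHull Q) x) where

  -- If x = t·A + (1-t)·z with A ∈ Q, z a convex combination of points of Q
  -- and 0 < t < 1, extremality gives A = x, hence x ∈ Q.
  proper-split⇒generator : ∀ {k} {A : Matrix m n} {S : Fin k → Matrix m n} {t} →
    Q A → (∀ s → Q (S s)) → 0ℚ <ℚ t → t <ℚ 1ℚ →
    Σ (Matrix m n) (λ z → (Σ (Fin k → ℚ) λ w → IsConvexCombination w S z)
                          × (x ≗ₘ λ i j → t * A i j + (1ℚ - t) * z i j)) →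
    Q x
  proper-split⇒generator {k} {A} {S} {t} QA QS t>0 t<1 (z , (w , z-comb) , x-split) =
    Q-resp (proj₁ A≗x,z≗x) QA
    where
    A≗x,z≗x = x-extreme A z t (generator-in-hull {Q = Q} QA) (k , w , S , QS , z-comb) t>0 t<1 x-split

  extreme-combination⇒generator : ∀ k (c : Fin k → ℚ) (S : Fin k → Matrix m n) →
    (∀ t → Q (S t)) → IsConvexCombination c S x → Q x
  extreme-combination⇒generator zero c S QS (_ , () , _)
  extreme-combination⇒generator (suc k) c S QS comb =
    by-first-weight (<-cmp 0ℚ (c zero)) (<-cmp (c zero) 1ℚ)
    where
    open FirstTerm {c = c} {S} {x} comb
    by-first-weight : Tri (0ℚ <ℚ c zero) (0ℚ ≡ c zero) (c zero <ℚ 0ℚ) →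
                      Tri (c zero <ℚ 1ℚ) (c zero ≡ 1ℚ) (1ℚ <ℚ c zero) → Q x
    by-first-weight (tri> _ _ c₀<0) _ = ⊥-elim (<-irrefl refl (<-≤-trans c₀<0 (proj₁ comb zero)))
    by-first-weight (tri≈ _ 0≡c₀ _) _ =
      extreme-combination⇒generator k (λ t → c (suc t)) (λ t → S (suc t)) (λ t → QS (suc t))
        (drop-zero-head (sym 0≡c₀))
    by-first-weight (tri< _ _ _) (tri> _ _ c₀>1) = ⊥-elim (<-irrefl refl (<-≤-trans c₀>1 head-weight≤1))
    by-first-weight (tri< _ _ _) (tri≈ _ c₀≡1 _) = Q-resp (λ i j → sym (unit-head c₀≡1 i j)) (QS zero)
    by-first-weight (tri< c₀>0 _ _) (tri< c₀<1 _ _) =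
      proper-split⇒generator (QS zero) (λ t → QS (suc t)) c₀>0 c₀<1 (split-head c₀>0 c₀<1)

  extreme⇒generator : InHull Q x → Q x
  extreme⇒generator (k , c , S , QS , comb) = extreme-combination⇒generator k c S QS comb

-- The sum of column j of M from the top down to row i (inclusive).
colSum : ∀ {m n} → Matrix m n → Fin m → Fin n → ℚ
colSum M i j = sumUpTo (λ i' → M i' j) (suc (toℕ i))

colSum-cong : ∀ {m n} {A B : Matrix m n} → A ≗ₘ B → ∀ i j → colSum A i j ≡ colSum B i j
colSum-cong A≗B i j = sumUpTo-cong (λ i' → A≗B i' j) (suc (toℕ i))

colSum-injective : ∀ {m n} (A B : Matrix m n) →
  (∀ i j → colSum A i j ≡ colSum B i j) → A ≗ₘ B
colSum-injective A B same i j =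
  partialSums-injective (λ i' → A i' j) (λ i' → B i' j) (λ i → same i j) i

colSum-combination : ∀ {m n k} (c : Fin k → ℚ) (S : Fin k → Matrix m n) i j →
  colSum (λ i j → sumFin (λ t → c t * S t i j)) i j ≡ sumFin (λ t → c t * colSum (S t) i j)
colSum-combination c S i j = sumUpTo-combination c (λ t i' → S t i' j) (suc (toℕ i))

colSum-affine : ∀ {m n} t (y z : Matrix m n) i j →
  colSum (λ i j → t * y i j + (1ℚ - t) * z i j) i j ≡ t * colSum y i j + (1ℚ - t) * colSum z i j
colSum-affine t y z i j = begin
  sumUpTo (λ i' → t * y i' j + (1ℚ - t) * z i' j) K
    ≡⟨ sumUpTo-+ (λ i' → t * y i' j) (λ i' → (1ℚ - t) * z i' j) K ⟩
  sumUpTo (λ i' → t * y i' j) K + sumUpTo (λ i' → (1ℚ - t) * z i' j) K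
    ≡⟨ cong₂ _+_ (sumUpTo-scale t (λ i' → y i' j) K) (sumUpTo-scale (1ℚ - t) (λ i' → z i' j) K) ⟩
  t * colSum y i j + (1ℚ - t) * colSum z i j
    ∎
  where K = suc (toℕ i)

-- Column partial sums of sign matrices lie in {0,1}, hence those of every
-- point of P(m,n) lie in [0,1].
colSum-unit : ∀ {m n} {p : Matrix m n} → InP m n p →
  ∀ i j → (0ℚ ≤ℚ colSum p i j) × (colSum p i j ≤ℚ 1ℚ)
colSum-unit (k , c , S , S-sign , c≥0 , Σc≡1 , p≗ΣcS) i j =
  subst (λ v → (0ℚ ≤ℚ v) × (v ≤ℚ 1ℚ))
    (sym (trans (colSum-cong p≗ΣcS i j) (colSum-combination c S i j)))
    (combination-unit c (λ t → colSum (S t) i j) c≥0 Σc≡1 λ t →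
      zeroOrOne⇒unit (proj₁ (proj₂ (S-sign t)) i j))
  where
  zeroOrOne⇒unit : ∀ {v} → (v ≡ 0ℚ) ⊎ (v ≡ 1ℚ) → (0ℚ ≤ℚ v) × (v ≤ℚ 1ℚ)
  zeroOrOne⇒unit (inj₁ refl) = ≤-refl , <⇒≤ (positive⁻¹ 1ℚ)
  zeroOrOne⇒unit (inj₂ refl) = <⇒≤ (positive⁻¹ 1ℚ) , ≤-refl

sign-resp : ∀ {m n} {A B : Matrix m n} → A ≗ₘ B → IsSignMatrix A → IsSignMatrix B
sign-resp A≗B (entries , colSums , rowSums) =
  (λ i j → subst (λ v → (v ≡ - 1ℚ) ⊎ (v ≡ 0ℚ) ⊎ (v ≡ 1ℚ)) (A≗B i j) (entries i j)) ,
  (λ i j → subst (λ v → (v ≡ 0ℚ) ⊎ (v ≡ 1ℚ)) (colSum-cong A≗B i j) (colSums i j)) ,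
  (λ i j → subst (0ℚ ≤ℚ_) (sumUpTo-cong (A≗B i) (suc (toℕ j))) (rowSums i j))

-- A proper convex combination t·y + (1-t)·z of points of P(m,n) equal to a
-- sign matrix X has the column partial sums of X in {0,1} as convex
-- combinations of column partial sums in [0,1]; extremality of 0 and 1 makes
-- those of y and z equal to those of X.
sign⇒extreme : ∀ {m n} {X : Matrix m n} → IsSignMatrix X → IsExtreme (InP m n) X
sign⇒extreme {X = X} (_ , X-colSums , _) y z t y∈P z∈P t>0 t<1 X≗split =
  colSum-injective y X (λ i j → proj₁ (same i j)) ,
  colSum-injective z X (λ i j → proj₂ (same i j))
  where
  same : ∀ i j → (colSum y i j ≡ colSum X i j) × (colSum z i j ≡ colSum X i j)
  same i j = unit-extreme t>0 t<1
    (proj₁ (colSum-unit y∈P i j)) (proj₂ (colSum-unit y∈P i j))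
    (proj₁ (colSum-unit z∈P i j)) (proj₂ (colSum-unit z∈P i j))
    (X-colSums i j)
    (trans (colSum-cong X≗split i j) (colSum-affine t y z i j))

-- Theorem 4.3: the vertices of P(m,n) are exactly the sign matrices.
-- (The argument does not need m, n ≥ 1.)
theorem4p3 : (m n : ℕ) → 1 ≤ m → 1 ≤ n →
    (x : Matrix m n) → IsVertex m n x ⇔ IsSignMatrix x
theorem4p3 m n _ _ x = mk⇔ vertex⇒sign sign⇒vertex
  where
  vertex⇒sign : IsVertex m n x → IsSignMatrix x
  vertex⇒sign (x∈P , x-extreme) = extreme⇒generator sign-resp x-extreme x∈P

  sign⇒vertex : IsSignMatrix x → IsVertex m n x
  sign⇒vertex x-sign = generator-in-hull x-sign , sign⇒extreme x-sign
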